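{- Let $v\in \mathbb{N}^n \cap \mathcal{T}$ be a point that is not a corner, and let $G=([n],\phi_v)$. Then $$m_{\mathcal{T}}(v)= \frac{1}{2^{|J(v)|+1}}\,|A(G)|.$$
   Context: Let $a_1,\ldots,a_n$ be positive integers, and let $\mathcal{T}=[0,a_1]\times\cdots\times[0,a_n]\subset\mathbb{R}^n$ be the billiard table. A ball starts at the origin and moves in direction $(1,\ldots,1)$. It is reflected elastically when it hits the boundary, and it stops when it reaches a corner. A corner is a point $w\in\mathcal{T}$ with $w_i\in\{0,a_i\}$ for all $i$. For $v\in\mathcal{T}$, the crossing number $m_{\mathcal{T}}(v)$ is the number of times the trajectory passes through $v$. Constraint satisfaction problems are defined as follows. Let $\mathcal{P}$ be the family of all subsets of $\{0,1\}\times\{0,1\}$. A boolean CSP on a finite set $V\subseteq\mathbb{N}$ is a pair $(V,\phi)$, where $\phi:\binom{V}{2}\to\mathcal{P}$. An assignment $g:V\to\{0,1\}$ is satisfying for $(V,\phi)$ if $(g(a),g(b))\notin\phi(\{a,b\})$ for every pair $a<b$ in $V$. We write $A(G)$ for the set of satisfying assignments of a CSP $G$. For $v\in\mathbb{N}^n\cap\mathcal{T}$, define $\phi_v:\binom{[n]}{2}\to\mathcal{P}$ by considering the congruences modulo $\gcd(2a_i,2a_j)$: - $\phi_v(ij)=\emptyset$ if $v_i\equiv -v_j$ and $v_i\equiv v_j$. - $\phi_v(ij)=\{(0,1),(1,0)\}$ if $v_i\equiv v_j$ but $v_i\not\equiv -v_j$. - $\phi_v(ij)=\{(0,0),(1,1)\}$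 if $v_i\equiv -v_j$ but $v_i\not\equiv v_j$. - $\phi_v(ij)=\{(0,0),(0,1),(1,0),(1,1)\}$ if $v_i\not\equiv -v_j$ and $v_i\not\equiv v_j$. Finally, let $J(v)=\{i\in[n]: v_i\equiv -v_i \pmod{2a_i}\}$. -}

module Defs where

open import Data.Nat using (ℕ; zero; suc; _+_; _*_; _∸_; _^_; _≤ᵇ_; _<ᵇ_; _≡ᵇ_; ∣_-_∣)
open import Data.Nat.DivMod using (_%_)
open import Data.Nat.GCD using (gcd)
open import Data.Nat.LCM using (lcm)
open import Data.Nat.Divisibility using (_∣?_)
open import Data.Bool using (Bool; true; false; _∧_; _∨_; not; if_then_else_; _xor_)
open import Data.Fin using (Fin; zero; suc; toℕ)
open import Data.List using (List; []; _∷_; _++_; map; upTo; allFin; concatMap)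
open import Data.Sum using (_⊎_)
open import Relation.Binary.PropositionalEquality using (_≡_)
open import Relation.Nullary.Decidable using (does)

allFinB : ∀ n → (Fin n → Bool) → Bool
allFinB zero    f = true
allFinB (suc n) f = f zero ∧ allFinB n (λ i → f (suc i))

allB : {A : Set} → (A → Bool) → List A → Bool
allB p []       = true
allB p (x ∷ xs) = p x ∧ allB p xs

countB : {A : Set} → (A → Bool) → List A → ℕ
countB p []       = 0
countB p (x ∷ xs) = (if p x then 1 else 0) + countB p xs

-- The billiard.  Table T = [0,a_1] × … × [0,a_n], a : Fin n → ℕ (a i > 0).

-- Position along one axis of length a at time t of a unit-speed ball that
-- starts at 0 moving in the positive direction, reflected elastically at 0
-- and a (the "folding" of t modulo 2a).
fold : ℕ → ℕ → ℕ
fold zero    t = 0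
fold (suc k) t =
  if (t % (2 * suc k)) ≤ᵇ suc k
  then t % (2 * suc k)
  else 2 * suc k ∸ (t % (2 * suc k))

pos : ∀ {n} → (Fin n → ℕ) → ℕ → Fin n → ℕ
pos a t i = fold (a i) t

IsCorner : ∀ {n} → (Fin n → ℕ) → (Fin n → ℕ) → Set
IsCorner a w = ∀ i → (w i ≡ 0) ⊎ (w i ≡ a i)

isCornerB : ∀ {n} → (Fin n → ℕ) → (Fin n → ℕ) → Bool
isCornerB {n} a w = allFinB n (λ i → (w i ≡ᵇ 0) ∨ (w i ≡ᵇ a i))

samePointB : ∀ {n} → (Fin n → ℕ) → (Fin n → ℕ) → Bool
samePointB {n} x y = allFinB n (λ i → x i ≡ᵇ y i)

-- lcm of all side lengths: the ball is certainly at a corner at this time,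
-- so it has stopped by then; used only as a finite search bound.
lcmAll : ∀ n → (Fin n → ℕ) → ℕ
lcmAll zero    a = 1
lcmAll (suc n) a = lcm (a zero) (lcmAll n (λ i → a (suc i)))

notStoppedBefore : ∀ {n} → (Fin n → ℕ) → ℕ → Bool
notStoppedBefore a t = allB (λ s → not (isCornerB a (pos a s))) (map suc (upTo (t ∸ 1)))

crossingNumber : ∀ {n} → (Fin n → ℕ) → (Fin n → ℕ) → ℕ
crossingNumber {n} a v =
  countB (λ t → samePointB (pos a t) v ∧ notStoppedBefore a t)
         (upTo (suc (lcmAll n a)))

-- Boolean CSPs on V = [n] (represented by Fin n).
-- An element of 𝒫 (a subset of {0,1}×{0,1}) is its membership function;
-- 0 ↔ false, 1 ↔ true.

Subset𝒫 : Set
Subset𝒫 = Bool → Bool → Bool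

CSP : ℕ → Set
CSP n = Fin n → Fin n → Subset𝒫   -- only used on pairs i < j

satisfyingB : ∀ {n} → CSP n → (Fin n → Bool) → Bool
satisfyingB {n} φ g =
  allFinB n (λ i → allFinB n (λ j →
    if toℕ i <ᵇ toℕ j then not (φ i j (g i) (g j)) else true))

consB : ∀ {n} → Bool → (Fin n → Bool) → Fin (suc n) → Bool
consB b g zero    = b
consB b g (suc i) = g i

allAssignments : ∀ n → List (Fin n → Bool)
allAssignments zero    = (λ ()) ∷ []
allAssignments (suc n) = concatMap (λ g → consB false g ∷ consB true g ∷ []) (allAssignments n)

numSatisfying : ∀ {n} → CSP n → ℕ
numSatisfying {n} φ = countB (satisfyingB φ) (allAssignments n)

congB : ℕ → ℕ → ℕ → Bool
congB d x y = does (d ∣? ∣ x - y ∣)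

negCongB : ℕ → ℕ → ℕ → Bool
negCongB d x y = does (d ∣? (x + y))

phi : ∀ {n} → (Fin n → ℕ) → (Fin n → ℕ) → CSP n
phi a v i j b c =
  let d  = gcd (2 * a i) (2 * a j)
      eq = congB d (v i) (v j)
      ng = negCongB d (v i) (v j)
  in if eq
     then (if ng then false else (b xor c))              -- ∅ / {(0,1),(1,0)}
     else (if ng then not (b xor c) else true)            -- {(0,0),(1,1)} / everything

sizeJ : ∀ {n} → (Fin n → ℕ) → (Fin n → ℕ) → ℕ
sizeJ {n} a v = countB (λ i → negCongB (2 * a i) (v i) (v i)) (allFin n)

{-# OPTIONS --safe #-}
-- Coordinate i of the ball at time t is fold (a i) t, and for v ≤ a one has fold a t = v iff
-- t ≡ ±v (mod 2a).  So the visits of v during one period [0, 2L), L = lcm a, correspond to the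
-- pairs (t, g) of a time and a sign vector g ∈ {0,1}ⁿ with t ≡ g_i v_i (mod 2 a_i) for all i
-- (g_i = 1 meaning the sign +).  A visit carries 2^|J(v)| sign vectors, because both signs work
-- at coordinate i exactly when v_i ≡ -v_i (mod 2 a_i).  Conversely, by the Chinese remainder
-- theorem a sign vector admits such a time t, unique modulo 2L, iff the residues g_i v_i are
-- pairwise congruent modulo gcd (2 a_i) (2 a_j): this is precisely g ∈ A(G).  Finally the ball
-- is at a corner at time L and at no earlier positive time, and t ↦ 2L - t preserves the
-- position, so [0, 2L) sees every visit of [0, L] twice (v, not a corner, is not visited at
-- times 0 and L).
module Submission where

open import Defs
open import Data.Nat as ℕ using (ℕ; zero; suc; NonZero; _≤_; _<_; _≤ᵇ_; _≡ᵇ_)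
import Data.Nat.Properties as ℕ
import Data.Nat.Divisibility as ℕ
open import Data.Nat.DivMod using (_%_; _/_; m≡m%n+[m/n]*n; m%n<n)
open import Data.Nat.GCD
  using (gcd; gcd-GCD; module Bézout; gcd[m,n]∣m; gcd[m,n]∣n; gcd-greatest; gcd-comm; gcd-zeroˡ;
         c*gcd[m,n]≡gcd[cm,cn]; gcd[m,n]≡0⇒m≡0; gcd[m,n]≡0⇒n≡0)
open import Data.Nat.LCM using (lcm; m∣lcm[m,n]; n∣lcm[m,n]; lcm-least; gcd*lcm)
open import Data.Nat.ListAction using (sum; product)
open import Data.Integer as ℤ using (ℤ; +_; -_)
import Data.Integer.Properties as ℤ
open import Data.Integer.DivMod using (_%ℕ_; _/ℕ_; a≡a%ℕn+[a/ℕn]*n; n%ℕd<d)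
open import Data.Integer.Divisibility.Signed
  using (_∣_; divides; ∣ᵤ⇒∣; ∣⇒∣ᵤ; ∣-trans; ∣m⇒∣-m; ∣m∣n⇒∣m+n; ∣m∣n⇒∣m-n)
open import Data.Bool using (Bool; true; false; _∧_; _∨_; not; if_then_else_; T; _xor_)
import Data.Bool.Properties as Bool
open import Data.Fin using (Fin; zero; suc; toℕ)
import Data.Fin.Properties as Fin
open import Data.List using (List; []; _∷_; _++_; [_]; map; upTo; applyUpTo; tabulate; concatMap)
import Data.List.Properties as List
open import Data.List.Relation.Unary.All using (All; []; _∷_)
open import Data.List.Relation.Unary.All.Properties using (applyUpTo⁺₁; map⁺)
open import Data.Product using (∃; ∃₂; _×_; _,_; proj₁; proj₂)
open import Data.Sum using (_⊎_; inj₁; inj₂)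
open import Data.Empty using (⊥-elim)
open import Function using (_∘_; id; _⇔_; mk⇔; Equivalence)
import Function.Properties.Equivalence as ⇔
open import Relation.Binary.PropositionalEquality
  using (_≡_; refl; sym; trans; cong; cong₂; subst; subst₂; module ≡-Reasoning)
open import Relation.Binary.Definitions using (tri<; tri≈; tri>)
open import Relation.Nullary using (¬_; proof)
open import Relation.Nullary.Reflects using (Reflects; ofʸ; ofⁿ; det; _×-reflects_; _⊎-reflects_; ¬-reflects)
open Equivalence using (to; from)

-- The integer operators are in scope only inside this block; outside it, _+_ and _*_ are those of ℕ.
module _ where

  open import Data.Integer using (_+_; _-_; _*_; _⊖_)
  open import Data.Integer.Tactic.RingSolver using (solve-∀)

  infix 4 _≡_mod_ _≡±_mod_

  -- A record rather than a synonym for + m ∣ x - y, so that x and y can be inferred.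
  record _≡_mod_ (x y : ℤ) (m : ℕ) : Set where
    constructor mk≡mod
    field ∣diff : + m ∣ x - y

  open _≡_mod_

  _≡±_mod_ : ℤ → ℤ → ℕ → Set
  x ≡± y mod m = x ≡ y mod m ⊎ x ≡ - y mod m

  module _ {m : ℕ} where

    ≡-mod-refl : ∀ {x} → x ≡ x mod m
    ≡-mod-refl {x} = mk≡mod (divides (+ 0) (ℤ.+-inverseʳ x))

    ≡-mod-sym : ∀ {x y} → x ≡ y mod m → y ≡ x mod m
    ≡-mod-sym {x} {y} (mk≡mod m∣x-y) = mk≡mod (subst (+ m ∣_) (negate x y) (∣m⇒∣-m m∣x-y))
      where
      negate : ∀ x y → - (x - y) ≡ y - x
      negate = solve-∀

    ≡-mod-trans : ∀ {x y z} → x ≡ y mod m → y ≡ z mod m → x ≡ z mod m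
    ≡-mod-trans {x} {y} {z} (mk≡mod m∣x-y) (mk≡mod m∣y-z) =
      mk≡mod (subst (+ m ∣_) (telescope x y z) (∣m∣n⇒∣m+n m∣x-y m∣y-z))
      where
      telescope : ∀ x y z → (x - y) + (y - z) ≡ x - z
      telescope = solve-∀

    ≡-mod-neg : ∀ {x y} → x ≡ y mod m → - x ≡ - y mod m
    ≡-mod-neg {x} {y} (mk≡mod m∣x-y) = mk≡mod (subst (+ m ∣_) (negate x y) (∣m⇒∣-m m∣x-y))
      where
      negate : ∀ x y → - (x - y) ≡ - x - - y
      negate = solve-∀

    ≡-mod-neg⁻ : ∀ {x y} → - x ≡ - y mod m → x ≡ y mod m
    ≡-mod-neg⁻ {x} {y} -x≡-y =
      subst₂ (λ u w → u ≡ w mod m) (ℤ.neg-involutive x) (ℤ.neg-involutive y) (≡-mod-neg -x≡-y)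

    ≡-mod-neg-swap : ∀ {x y} → x ≡ - y mod m → - x ≡ y mod m
    ≡-mod-neg-swap {y = y} x≡-y = subst (λ z → _ ≡ z mod m) (ℤ.neg-involutive y) (≡-mod-neg x≡-y)

    ≡-mod-neg-swap⁻ : ∀ {x y} → - x ≡ y mod m → x ≡ - y mod m
    ≡-mod-neg-swap⁻ {x} -x≡y = subst (λ z → z ≡ _ mod m) (ℤ.neg-involutive x) (≡-mod-neg -x≡y)

    ≡±-mod-sym : ∀ {x y} → x ≡± y mod m → y ≡± x mod m
    ≡±-mod-sym (inj₁ x≡y)  = inj₁ (≡-mod-sym x≡y)
    ≡±-mod-sym (inj₂ x≡-y) = inj₂ (≡-mod-neg-swap⁻ (≡-mod-sym x≡-y))

    ≡±-mod-trans : ∀ {x y z} → x ≡± y mod m → y ≡± z mod m → x ≡± z mod m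
    ≡±-mod-trans (inj₁ x≡y)  (inj₁ y≡z)  = inj₁ (≡-mod-trans x≡y y≡z)
    ≡±-mod-trans (inj₁ x≡y)  (inj₂ y≡-z) = inj₂ (≡-mod-trans x≡y y≡-z)
    ≡±-mod-trans (inj₂ x≡-y) (inj₁ y≡z)  = inj₂ (≡-mod-trans x≡-y (≡-mod-neg y≡z))
    ≡±-mod-trans (inj₂ x≡-y) (inj₂ y≡-z) = inj₁ (≡-mod-trans x≡-y (≡-mod-neg-swap y≡-z))

    +-*-≡-mod : ∀ x k → x + k * + m ≡ x mod m
    +-*-≡-mod x k = mk≡mod (divides k (cancel x (k * + m)))
      where
      cancel : ∀ x y → x + y - x ≡ y
      cancel = solve-∀

    %-≡-mod : ∀ t .{{_ : NonZero m}} → + t ≡ + (t % m) mod m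
    %-≡-mod t = subst (λ z → z ≡ + (t % m) mod m) (sym t≡r+qm) (+-*-≡-mod (+ (t % m)) (+ (t / m)))
      where
      open ≡-Reasoning
      t≡r+qm : + t ≡ + (t % m) + + (t / m) * + m
      t≡r+qm = begin
        + t                             ≡⟨ cong +_ (m≡m%n+[m/n]*n t m) ⟩
        + (t % m ℕ.+ t / m ℕ.* m)       ≡⟨ ℤ.pos-+ (t % m) (t / m ℕ.* m) ⟩
        + (t % m) + + (t / m ℕ.* m)     ≡⟨ cong (λ z → + (t % m) + z) (ℤ.pos-* (t / m) m) ⟩
        + (t % m) + + (t / m) * + m     ∎

    %ℕ-≡-mod : ∀ x .{{_ : NonZero m}} → x ≡ + (x %ℕ m) mod m
    %ℕ-≡-mod x = subst (λ z → z ≡ + (x %ℕ m) mod m) (sym (a≡a%ℕn+[a/ℕn]*n x m)) (+-*-≡-mod _ (x /ℕ m))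

    +[N∸r]≡-+r : ∀ {N r} → m ℕ.∣ N → r ≤ N → + (N ℕ.∸ r) ≡ - + r mod m
    +[N∸r]≡-+r {N} {r} (ℕ.divides q refl) r≤N =
      subst (λ z → z ≡ - + r mod m) -r+N≡N∸r (+-*-≡-mod (- + r) (+ q))
      where
      open ≡-Reasoning
      -r+N≡N∸r : - + r + + q * + m ≡ + (N ℕ.∸ r)
      -r+N≡N∸r = begin
        - + r + + q * + m     ≡⟨ cong (λ z → - + r + z) (ℤ.pos-* q m) ⟨
        - + r + + N           ≡⟨ ℤ.+-comm (- + r) (+ N) ⟩
        + N + - + r           ≡⟨ ℤ.m-n≡m⊖n N r ⟩
        N ⊖ r                 ≡⟨ ℤ.⊖-≥ r≤N ⟩
        + (N ℕ.∸ r)           ∎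

    ≡-mod-∣ : ∀ {x y} → x ≡ y mod m → + m ∣ x → + m ∣ y
    ≡-mod-∣ {x} {y} (mk≡mod m∣x-y) m∣x = subst (+ m ∣_) (cancel x y) (∣m∣n⇒∣m-n m∣x m∣x-y)
      where
      cancel : ∀ x y → x - (x - y) ≡ y
      cancel = solve-∀

    ≡±-mod-∣ : ∀ {x y} → x ≡± y mod m → + m ∣ x → + m ∣ y
    ≡±-mod-∣ (inj₁ x≡y)  m∣x = ≡-mod-∣ x≡y m∣x
    ≡±-mod-∣ (inj₂ x≡-y) m∣x = subst (+ m ∣_) (ℤ.neg-involutive _) (∣m⇒∣-m (≡-mod-∣ x≡-y m∣x))

  ≡-mod-weaken : ∀ {d m x y} → d ℕ.∣ m → x ≡ y mod m → x ≡ y mod d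
  ≡-mod-weaken d∣m (mk≡mod m∣x-y) = mk≡mod (∣-trans (∣ᵤ⇒∣ d∣m) m∣x-y)

  ∣⊖∣≡∣-∣ : ∀ x y → ℤ.∣ x ⊖ y ∣ ≡ ℕ.∣ x - y ∣
  ∣⊖∣≡∣-∣ zero    zero    = refl
  ∣⊖∣≡∣-∣ zero    (suc y) = refl
  ∣⊖∣≡∣-∣ (suc x) zero    = refl
  ∣⊖∣≡∣-∣ (suc x) (suc y) = trans (cong ℤ.∣_∣ (ℤ.[1+m]⊖[1+n]≡m⊖n x y)) (∣⊖∣≡∣-∣ x y)

  +≡+-mod⇔ : ∀ {m x y} → + x ≡ + y mod m ⇔ m ℕ.∣ ℕ.∣ x - y ∣
  +≡+-mod⇔ {m} {x} {y} = mk⇔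
    (λ (mk≡mod m∣x-y) → subst (m ℕ.∣_) ∣+x-+y∣≡∣x-y∣ (∣⇒∣ᵤ m∣x-y))
    (λ m∣∣x-y∣ → mk≡mod (∣ᵤ⇒∣ (subst (m ℕ.∣_) (sym ∣+x-+y∣≡∣x-y∣) m∣∣x-y∣)))
    where
    ∣+x-+y∣≡∣x-y∣ : ℤ.∣ + x - + y ∣ ≡ ℕ.∣ x - y ∣
    ∣+x-+y∣≡∣x-y∣ = trans (cong ℤ.∣_∣ (ℤ.m-n≡m⊖n x y)) (∣⊖∣≡∣-∣ x y)

  +≡-+-mod⇔ : ∀ {m x y} → + x ≡ - + y mod m ⇔ m ℕ.∣ x ℕ.+ y
  +≡-+-mod⇔ {m} {x} {y} = mk⇔
    (λ (mk≡mod m∣x+y) → subst (λ z → m ℕ.∣ ℤ.∣ z ∣) x--y≡x+y (∣⇒∣ᵤ m∣x+y))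
    (λ m∣x+y → mk≡mod (subst (+ m ∣_) (sym x--y≡x+y) (∣ᵤ⇒∣ m∣x+y)))
    where
    x--y≡x+y : + x - - + y ≡ + (x ℕ.+ y)
    x--y≡x+y = trans (cong (λ z → + x + z) (ℤ.neg-involutive (+ y))) (sym (ℤ.pos-+ x y))

  ∣∧≤⇒≡0⊎≡ : ∀ {m k} → m ℕ.∣ k → k ≤ m → k ≡ 0 ⊎ k ≡ m
  ∣∧≤⇒≡0⊎≡ {k = zero}  _   _   = inj₁ refl
  ∣∧≤⇒≡0⊎≡ {k = suc k} m∣k k≤m = inj₂ (ℕ.≤-antisym k≤m (ℕ.∣⇒≤ m∣k))

  +≡+-mod⇒≡ : ∀ {m x y} → ℕ.∣ x - y ∣ < m → + x ≡ + y mod m → x ≡ y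
  +≡+-mod⇒≡ ∣x-y∣<m x≡y with ∣∧≤⇒≡0⊎≡ (to +≡+-mod⇔ x≡y) (ℕ.<⇒≤ ∣x-y∣<m)
  ... | inj₁ ∣x-y∣≡0 = ℕ.∣m-n∣≡0⇒m≡n ∣x-y∣≡0
  ... | inj₂ ∣x-y∣≡m = ⊥-elim (ℕ.<-irrefl ∣x-y∣≡m ∣x-y∣<m)

  private
    bezout-ℕ⇒ℤ : ∀ g x A y B → g ℕ.+ y ℕ.* B ≡ x ℕ.* A → + g ≡ + x * + A + - + y * + B
    bezout-ℕ⇒ℤ g x A y B g+yB≡xA = begin
      + g                             ≡⟨ cancel (+ g) (+ y * + B) ⟩
      + g + + y * + B - + y * + B     ≡⟨ cong (λ z → z - + y * + B) lifted ⟩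
      + x * + A - + y * + B           ≡⟨ cong (λ z → + x * + A + z) (ℤ.neg-distribˡ-* (+ y) (+ B)) ⟩
      + x * + A + - + y * + B         ∎
      where
      open ≡-Reasoning
      cancel : ∀ g p → g ≡ g + p - p
      cancel = solve-∀
      lifted : + g + + y * + B ≡ + x * + A
      lifted = begin
        + g + + y * + B         ≡⟨ cong (λ z → + g + z) (ℤ.pos-* y B) ⟨
        + g + + (y ℕ.* B)       ≡⟨ ℤ.pos-+ g (y ℕ.* B) ⟨
        + (g ℕ.+ y ℕ.* B)       ≡⟨ cong +_ g+yB≡xA ⟩
        + (x ℕ.* A)             ≡⟨ ℤ.pos-* x A ⟩
        + x * + A               ∎

  bezout : ∀ A B → ∃₂ λ u w → + gcd A B ≡ u * + A + w * + B
  bezout A B with Bézout.identity (gcd-GCD A B)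
  ... | Bézout.+- x y eq = + x , - + y , bezout-ℕ⇒ℤ _ x A y B eq
  ... | Bézout.-+ x y eq = - + x , + y , trans (bezout-ℕ⇒ℤ _ y B x A eq) (ℤ.+-comm (+ y * + B) (- + x * + A))

  crt₂ : ∀ A B {x₁ x₂} → x₁ ≡ x₂ mod gcd A B → ∃ λ x → x ≡ x₁ mod A × x ≡ x₂ mod B
  crt₂ A B {x₁} {x₂} (mk≡mod (divides k x₁-x₂≡k*g)) with u , w , g≡uA+wB ← bezout A B =
    x₁ - k * u * + A ,
    mk≡mod (divides (- (k * u)) (shift x₁ (k * u) (+ A))) ,
    mk≡mod (divides (k * w) (begin
      x₁ - k * u * + A - x₂
        ≡⟨ swap x₁ x₂ (k * u * + A) ⟩
      (x₁ - x₂) - k * u * + A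
        ≡⟨ cong (λ z → z - k * u * + A) (trans x₁-x₂≡k*g (cong (k *_) g≡uA+wB)) ⟩
      k * (u * + A + w * + B) - k * u * + A
        ≡⟨ expand k u w (+ A) (+ B) ⟩
      k * w * + B
        ∎))
    where
    open ≡-Reasoning
    shift : ∀ x c A → x - c * A - x ≡ - c * A
    shift = solve-∀
    swap : ∀ x y z → x - z - y ≡ (x - y) - z
    swap = solve-∀
    expand : ∀ k u w A B → k * (u * A + w * B) - k * u * A ≡ k * w * B
    expand = solve-∀

  -- With g₁, g₂ the gcds on the right, h = gcd g₁ g₂ and d the left side: d h divides
  -- g₁ g₂ = h · lcm g₁ g₂, since g₁ g₂ is a gcd of n m, n c, c m, c c, each divisible by d h.
  gcd[lcm[m,n],c]∣lcm[gcd[m,c],gcd[n,c]] : ∀ m n c .{{_ : NonZero c}} →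
    gcd (lcm m n) c ℕ.∣ lcm (gcd m c) (gcd n c)
  gcd[lcm[m,n],c]∣lcm[gcd[m,c],gcd[n,c]] m n c =
    ℕ.*-cancelˡ-∣ h (subst₂ ℕ._∣_ (ℕ.*-comm d h) (sym (gcd*lcm g₁ g₂)) dh∣g₁g₂)
    where
    g₁ : ℕ
    g₁ = gcd m c
    g₂ : ℕ
    g₂ = gcd n c
    h : ℕ
    h = gcd g₁ g₂
    d : ℕ
    d = gcd (lcm m n) c
    instance
      h≢0 : NonZero h
      h≢0 = ℕ.≢-nonZero (λ h≡0 → ℕ.≢-nonZero⁻¹ c (gcd[m,n]≡0⇒n≡0 m (gcd[m,n]≡0⇒m≡0 h≡0)))
    h∣m : h ℕ.∣ m
    h∣m = ℕ.∣-trans (gcd[m,n]∣m g₁ g₂) (gcd[m,n]∣m m c)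
    h∣n : h ℕ.∣ n
    h∣n = ℕ.∣-trans (gcd[m,n]∣n g₁ g₂) (gcd[m,n]∣m n c)
    h∣c : h ℕ.∣ c
    h∣c = ℕ.∣-trans (gcd[m,n]∣m g₁ g₂) (gcd[m,n]∣n m c)
    d∣c : d ℕ.∣ c
    d∣c = gcd[m,n]∣n (lcm m n) c
    dh∣nm : d ℕ.* h ℕ.∣ n ℕ.* m
    dh∣nm = subst (d ℕ.* h ℕ.∣_) (trans (ℕ.*-comm (lcm m n) (gcd m n)) (trans (gcd*lcm m n) (ℕ.*-comm m n)))
              (ℕ.*-pres-∣ (gcd[m,n]∣m (lcm m n) c) (gcd-greatest h∣m h∣n))
    dh∣g₁n : d ℕ.* h ℕ.∣ g₁ ℕ.* n
    dh∣g₁n = subst (d ℕ.* h ℕ.∣_) (trans (sym (c*gcd[m,n]≡gcd[cm,cn] n m c)) (ℕ.*-comm n g₁))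
               (gcd-greatest dh∣nm (subst (d ℕ.* h ℕ.∣_) (ℕ.*-comm c n) (ℕ.*-pres-∣ d∣c h∣n)))
    dh∣g₁c : d ℕ.* h ℕ.∣ g₁ ℕ.* c
    dh∣g₁c = subst (d ℕ.* h ℕ.∣_) (trans (sym (c*gcd[m,n]≡gcd[cm,cn] c m c)) (ℕ.*-comm c g₁))
               (gcd-greatest (ℕ.*-pres-∣ d∣c h∣m) (ℕ.*-pres-∣ d∣c h∣c))
    dh∣g₁g₂ : d ℕ.* h ℕ.∣ g₁ ℕ.* g₂
    dh∣g₁g₂ = subst (d ℕ.* h ℕ.∣_) (sym (c*gcd[m,n]≡gcd[cm,cn] g₁ n c)) (gcd-greatest dh∣g₁n dh∣g₁c)

  m∣lcmAll : ∀ {n} (m : Fin n → ℕ) i → m i ℕ.∣ lcmAll n m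
  m∣lcmAll {suc n} m zero    = m∣lcm[m,n] (m zero) (lcmAll n (m ∘ suc))
  m∣lcmAll {suc n} m (suc i) = ℕ.∣-trans (m∣lcmAll (m ∘ suc) i) (n∣lcm[m,n] (m zero) (lcmAll n (m ∘ suc)))

  lcmAll-least : ∀ {n} (m : Fin n → ℕ) {y} → (∀ i → m i ℕ.∣ y) → lcmAll n m ℕ.∣ y
  lcmAll-least {zero}  m _   = ℕ.1∣ _
  lcmAll-least {suc n} m m∣y = lcm-least (m∣y zero) (lcmAll-least (m ∘ suc) (m∣y ∘ suc))

  lcmAll-nonZero : ∀ {n} (m : Fin n → ℕ) → (∀ i → NonZero (m i)) → NonZero (lcmAll n m)
  lcmAll-nonZero {zero}  m _   = _
  lcmAll-nonZero {suc n} m m≢0 =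
    ℕ.m*n≢0⇒n≢0 (gcd (m zero) L′) {{subst NonZero (sym (gcd*lcm (m zero) L′)) m₀L′≢0}}
    where
    L′ : ℕ
    L′ = lcmAll n (m ∘ suc)
    m₀L′≢0 : NonZero (m zero ℕ.* L′)
    m₀L′≢0 = ℕ.m*n≢0 (m zero) L′ {{m≢0 zero}} {{lcmAll-nonZero (m ∘ suc) (m≢0 ∘ suc)}}

  gcd[lcmAll,c]∣ : ∀ {n} (m : Fin n → ℕ) c .{{_ : NonZero c}} {y} →
    (∀ i → gcd (m i) c ℕ.∣ y) → gcd (lcmAll n m) c ℕ.∣ y
  gcd[lcmAll,c]∣ {zero}  m c _     = subst (ℕ._∣ _) (sym (gcd-zeroˡ c)) (ℕ.1∣ _)
  gcd[lcmAll,c]∣ {suc n} m c gcd∣y = ℕ.∣-trans (gcd[lcm[m,n],c]∣lcm[gcd[m,c],gcd[n,c]] (m zero) _ c)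
    (lcm-least (gcd∣y zero) (gcd[lcmAll,c]∣ (m ∘ suc) c (gcd∣y ∘ suc)))

  ≡-mod-gcd[lcmAll,c] : ∀ {n} (m : Fin n → ℕ) c .{{_ : NonZero c}} {x y} →
    (∀ i → x ≡ y mod gcd (m i) c) → x ≡ y mod gcd (lcmAll n m) c
  ≡-mod-gcd[lcmAll,c] m c x≡y = mk≡mod (∣ᵤ⇒∣ (gcd[lcmAll,c]∣ m c (λ i → ∣⇒∣ᵤ (∣diff (x≡y i)))))

  ≡-mod-*lcmAll : ∀ {n} (m : Fin n → ℕ) c .{{_ : NonZero c}} {x y} →
    x ≡ y mod c → (∀ i → x ≡ y mod c ℕ.* m i) → x ≡ y mod c ℕ.* lcmAll n m
  ≡-mod-*lcmAll m c {x} {y} (mk≡mod c∣x-y) x≡y with ℕ.divides q ∣x-y∣≡qc ← ∣⇒∣ᵤ c∣x-y =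
    mk≡mod (∣ᵤ⇒∣ (subst (c ℕ.* lcmAll _ m ℕ.∣_) (sym ∣x-y∣≡cq)
                        (ℕ.*-monoʳ-∣ c (lcmAll-least m m∣q))))
    where
    ∣x-y∣≡cq : ℤ.∣ x - y ∣ ≡ c ℕ.* q
    ∣x-y∣≡cq = trans ∣x-y∣≡qc (ℕ.*-comm q c)
    m∣q : ∀ i → m i ℕ.∣ q
    m∣q i = ℕ.*-cancelˡ-∣ c (subst (c ℕ.* m i ℕ.∣_) ∣x-y∣≡cq (∣⇒∣ᵤ (∣diff (x≡y i))))

  Compatible : ∀ {n} → (Fin n → ℕ) → (Fin n → ℤ) → Set
  Compatible m r = ∀ i j → r i ≡ r j mod gcd (m i) (m j)

  solution⇒compatible : ∀ {n} {m : Fin n → ℕ} {r x} → (∀ i → x ≡ r i mod m i) → Compatible m r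
  solution⇒compatible {m = m} x≡r i j =
    ≡-mod-trans (≡-mod-sym (≡-mod-weaken (gcd[m,n]∣m (m i) (m j)) (x≡r i)))
                (≡-mod-weaken (gcd[m,n]∣n (m i) (m j)) (x≡r j))

  crt : ∀ {n} (m : Fin n → ℕ) (r : Fin n → ℤ) → (∀ i → NonZero (m i)) → Compatible m r →
        ∃ λ x → ∀ i → x ≡ r i mod m i
  crt {zero}  m r _   _          = + 0 , λ ()
  crt {suc n} m r m≢0 compatible =
    extend (crt (m ∘ suc) (r ∘ suc) (m≢0 ∘ suc) (λ i j → compatible (suc i) (suc j)))
    where
    instance
      m₀≢0 : NonZero (m zero)
      m₀≢0 = m≢0 zero
    L′ : ℕ
    L′ = lcmAll n (m ∘ suc)
    extend : (∃ λ x′ → ∀ i → x′ ≡ r (suc i) mod m (suc i)) → ∃ λ x → ∀ i → x ≡ r i mod m i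
    extend (x′ , x′≡r) = combine (crt₂ L′ (m zero) x′≡r₀)
      where
      x′≡r₀ : x′ ≡ r zero mod gcd L′ (m zero)
      x′≡r₀ = ≡-mod-gcd[lcmAll,c] (m ∘ suc) (m zero) λ i →
                ≡-mod-trans (≡-mod-weaken (gcd[m,n]∣m _ _) (x′≡r i)) (compatible (suc i) zero)
      combine : (∃ λ x → x ≡ x′ mod L′ × x ≡ r zero mod m zero) → ∃ λ x → ∀ i → x ≡ r i mod m i
      combine (x , x≡x′ , x≡r₀) = x , λ where
        zero    → x≡r₀
        (suc i) → ≡-mod-trans (≡-mod-weaken (m∣lcmAll (m ∘ suc) i) x≡x′) (x′≡r i)

open import Data.Nat using (_+_; _*_; _∸_; _^_)
open import Data.Nat.Tactic.RingSolver using (solve-∀)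

2*a≡a+a : ∀ a → 2 * a ≡ a + a
2*a≡a+a a = cong (_+_ a) (ℕ.+-identityʳ a)

fold-spec : ∀ a t .{{_ : NonZero a}} → fold a t ≤ a × + t ≡± + fold a t mod (2 * a)
fold-spec (suc k) t with t % (2 * suc k) ≤ᵇ suc k | ℕ.≤ᵇ-reflects-≤ (t % (2 * suc k)) (suc k)
... | true  | ofʸ r≤a = r≤a , inj₁ (%-≡-mod t)
... | false | ofⁿ r≰a = m∸r≤a , inj₂ (≡-mod-trans (%-≡-mod t) r≡-[m∸r])
  where
  a : ℕ
  a = suc k
  m : ℕ
  m = 2 * a
  r : ℕ
  r = t % m
  m∸r≤a : m ∸ r ≤ a
  m∸r≤a = ℕ.≤-trans (ℕ.∸-monoʳ-≤ m (ℕ.<⇒≤ (ℕ.≰⇒> r≰a)))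
                    (ℕ.≤-reflexive (trans (cong (_∸ a) (2*a≡a+a a)) (ℕ.m+n∸m≡n a a)))
  r≡-[m∸r] : + r ≡ - + (m ∸ r) mod m
  r≡-[m∸r] = ≡-mod-sym (≡-mod-neg-swap (+[N∸r]≡-+r (ℕ.∣-refl {m}) (ℕ.<⇒≤ (m%n<n t m))))

fold≤ : ∀ a t .{{_ : NonZero a}} → fold a t ≤ a
fold≤ a t = proj₁ (fold-spec a t)

≤∧≤∧+≡+⇒≡ : ∀ {a f v} → f ≤ a → v ≤ a → f + v ≡ a + a → f ≡ a
≤∧≤∧+≡+⇒≡ {a} {f} {v} f≤a v≤a f+v≡a+a = ℕ.≤-antisym f≤a
  (ℕ.+-cancelʳ-≤ a a f (ℕ.≤-trans (ℕ.≤-reflexive (sym f+v≡a+a)) (ℕ.+-monoʳ-≤ f v≤a)))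

±-unique : ∀ {a f v} .{{_ : NonZero a}} → f ≤ a → v ≤ a → + f ≡± + v mod (2 * a) → f ≡ v
±-unique {a} {f} {v} f≤a v≤a (inj₁ f≡v) = +≡+-mod⇒≡ ∣f-v∣<2a f≡v
  where
  ∣f-v∣<2a : ℕ.∣ f - v ∣ < 2 * a
  ∣f-v∣<2a = ℕ.≤-<-trans (ℕ.≤-trans (ℕ.∣m-n∣≤m⊔n f v) (ℕ.⊔-lub f≤a v≤a))
                        (subst (a <_) (sym (2*a≡a+a a)) (ℕ.m<m+n a (ℕ.>-nonZero⁻¹ a)))
±-unique {a} {f} {v} f≤a v≤a (inj₂ f≡-v)
  with ∣∧≤⇒≡0⊎≡ (to +≡-+-mod⇔ f≡-v) (subst (f + v ≤_) (sym (2*a≡a+a a)) (ℕ.+-mono-≤ f≤a v≤a))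
... | inj₁ f+v≡0  = trans (ℕ.m+n≡0⇒m≡0 f f+v≡0) (sym (ℕ.m+n≡0⇒n≡0 f f+v≡0))
... | inj₂ f+v≡2a = trans (≤∧≤∧+≡+⇒≡ f≤a v≤a (trans f+v≡2a (2*a≡a+a a)))
                          (sym (≤∧≤∧+≡+⇒≡ v≤a f≤a (trans (ℕ.+-comm v f) (trans f+v≡2a (2*a≡a+a a)))))

fold-cong : ∀ a .{{_ : NonZero a}} {s t} → + s ≡± + t mod (2 * a) → fold a s ≡ fold a t
fold-cong a {s} {t} s≡±t = ±-unique (fold≤ a s) (fold≤ a t)
  (≡±-mod-trans (≡±-mod-sym (proj₂ (fold-spec a s))) (≡±-mod-trans s≡±t (proj₂ (fold-spec a t))))

fold≡⇔ : ∀ a .{{_ : NonZero a}} {t v} → v ≤ a → fold a t ≡ v ⇔ + t ≡± + v mod (2 * a)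
fold≡⇔ a {t} v≤a = mk⇔
  (λ { refl → proj₂ (fold-spec a t) })
  (λ t≡±v → ±-unique (fold≤ a t) v≤a (≡±-mod-trans (≡±-mod-sym (proj₂ (fold-spec a t))) t≡±v))

fold-at-wall⇔∣ : ∀ a .{{_ : NonZero a}} t → (fold a t ≡ 0 ⊎ fold a t ≡ a) ⇔ a ℕ.∣ t
fold-at-wall⇔∣ a t = mk⇔ wall⇒∣ ∣⇒wall
  where
  f : ℕ
  f = fold a t
  t≡±f : + t ≡± + f mod a
  t≡±f with proj₂ (fold-spec a t)
  ... | inj₁ t≡f  = inj₁ (≡-mod-weaken (ℕ.n∣m*n 2) t≡f)
  ... | inj₂ t≡-f = inj₂ (≡-mod-weaken (ℕ.n∣m*n 2) t≡-f)
  a∣f : f ≡ 0 ⊎ f ≡ a → a ℕ.∣ f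
  a∣f (inj₁ f≡0) = subst (a ℕ.∣_) (sym f≡0) (a ℕ.∣0)
  a∣f (inj₂ f≡a) = subst (a ℕ.∣_) (sym f≡a) ℕ.∣-refl
  wall⇒∣ : f ≡ 0 ⊎ f ≡ a → a ℕ.∣ t
  wall⇒∣ wall = ∣⇒∣ᵤ (≡±-mod-∣ (≡±-mod-sym t≡±f) (∣ᵤ⇒∣ (a∣f wall)))
  ∣⇒wall : a ℕ.∣ t → f ≡ 0 ⊎ f ≡ a
  ∣⇒wall a∣t = ∣∧≤⇒≡0⊎≡ (∣⇒∣ᵤ (≡±-mod-∣ t≡±f (∣ᵤ⇒∣ a∣t))) (fold≤ a t)

map-reflects : ∀ {A B : Set} {b} → A ⇔ B → Reflects A b → Reflects B b
map-reflects A⇔B (ofʸ a)  = ofʸ (to A⇔B a)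
map-reflects A⇔B (ofⁿ ¬a) = ofⁿ (¬a ∘ from A⇔B)

reflects-T⇔ : ∀ {A : Set} {b} → Reflects A b → T b ⇔ A
reflects-T⇔ (ofʸ a)  = mk⇔ (λ _ → a) (λ _ → _)
reflects-T⇔ (ofⁿ ¬a) = mk⇔ (λ ()) ¬a

≡ᵇ-reflects-≡ : ∀ m n → Reflects (m ≡ n) (m ≡ᵇ n)
≡ᵇ-reflects-≡ m n = proof (m ℕ.≟ n)

allFinB-reflects : ∀ {n} {P : Fin n → Set} {f : Fin n → Bool} →
  (∀ i → Reflects (P i) (f i)) → Reflects (∀ i → P i) (allFinB n f)
allFinB-reflects {zero}  _ = ofʸ λ ()
allFinB-reflects {suc n} r =
  map-reflects (mk⇔ (λ (p₀ , p₊) → λ { zero → p₀ ; (suc i) → p₊ i }) (λ p → p zero , p ∘ suc))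
               (r zero ×-reflects allFinB-reflects (r ∘ suc))

T-allB : ∀ {A : Set} {p : A → Bool} {xs} → All (T ∘ p) xs → T (allB p xs)
T-allB []         = _
T-allB (px ∷ pxs) = from Bool.T-∧ (px , T-allB pxs)

isCornerB-reflects : ∀ {n} (a w : Fin n → ℕ) → Reflects (IsCorner a w) (isCornerB a w)
isCornerB-reflects a w = allFinB-reflects λ i → ≡ᵇ-reflects-≡ (w i) 0 ⊎-reflects ≡ᵇ-reflects-≡ (w i) (a i)

congB-reflects : ∀ d x y → Reflects (+ x ≡ + y mod d) (congB d x y)
congB-reflects d x y = map-reflects (⇔.sym +≡+-mod⇔) (proof (d ℕ.∣? ℕ.∣ x - y ∣))

negCongB-reflects : ∀ d x y → Reflects (+ x ≡ - + y mod d) (negCongB d x y)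
negCongB-reflects d x y = map-reflects (⇔.sym +≡-+-mod⇔) (proof (d ℕ.∣? (x + y)))

signed : Bool → ℕ → ℤ
signed b x = if b then + x else - + x

-- The body of phi, with e and g its two congruence tests and x = b xor c.
phi-table : ∀ e g x → not (if e then (if g then false else x) else (if g then not x else true)) ≡ (if x then g else e)
phi-table true  true  true  = refl
phi-table true  true  false = refl
phi-table true  false true  = refl
phi-table true  false false = refl
phi-table false true  true  = refl
phi-table false true  false = refl
phi-table false false true  = refl
phi-table false false false = refl

phi-reflects : ∀ {n} (a v : Fin n → ℕ) i j b c →
  Reflects (signed b (v i) ≡ signed c (v j) mod gcd (2 * a i) (2 * a j)) (not (phi a v i j b c))
phi-reflects a v i j b c = subst (Reflects _) (sym (phi-table (congB d x y) (negCongB d x y) (b xor c))) (by-signs b c)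
  where
  d : ℕ
  d = gcd (2 * a i) (2 * a j)
  x : ℕ
  x = v i
  y : ℕ
  y = v j
  by-signs : ∀ b c → Reflects (signed b x ≡ signed c y mod d) (if b xor c then negCongB d x y else congB d x y)
  by-signs true  true  = congB-reflects d x y
  by-signs false false = map-reflects (mk⇔ ≡-mod-neg ≡-mod-neg⁻) (congB-reflects d x y)
  by-signs true  false = negCongB-reflects d x y
  by-signs false true  = map-reflects (mk⇔ ≡-mod-neg-swap ≡-mod-neg-swap⁻) (negCongB-reflects d x y)

if-<ᵇ-reflects : ∀ m n {A : Set} {b} → Reflects A b → Reflects (m < n → A) (if m ℕ.<ᵇ n then b else true)
if-<ᵇ-reflects m n r with m ℕ.<ᵇ n | ℕ.<ᵇ-reflects-< m n
... | true  | ofʸ m<n = map-reflects (mk⇔ (λ a _ → a) (λ f → f m<n)) r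
... | false | ofⁿ m≮n = ofʸ (λ m<n → ⊥-elim (m≮n m<n))

upper-triangle⇔ : ∀ {n} {C : Fin n → Fin n → Set} → (∀ {i} → C i i) → (∀ {i j} → C i j → C j i) →
  (∀ i j → toℕ i < toℕ j → C i j) ⇔ (∀ i j → C i j)
upper-triangle⇔ {C = C} C-refl C-sym = mk⇔ everywhere (λ c i j _ → c i j)
  where
  everywhere : (∀ i j → toℕ i < toℕ j → C i j) → ∀ i j → C i j
  everywhere c i j with ℕ.<-cmp (toℕ i) (toℕ j)
  ... | tri< i<j _ _ = c i j i<j
  ... | tri≈ _ i≡j _ rewrite Fin.toℕ-injective i≡j = C-refl
  ... | tri> _ _ j<i = C-sym (c j i j<i)

satisfyingB-reflects : ∀ {n} (a v : Fin n → ℕ) g →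
  Reflects (Compatible (λ i → 2 * a i) (λ i → signed (g i) (v i))) (satisfyingB (phi a v) g)
satisfyingB-reflects a v g =
  map-reflects (upper-triangle⇔ ≡-mod-refl compatible-sym)
    (allFinB-reflects λ i → allFinB-reflects λ j →
      if-<ᵇ-reflects (toℕ i) (toℕ j) (phi-reflects a v i j (g i) (g j)))
  where
  compatible-sym : ∀ {i j x y} → x ≡ y mod gcd (2 * a i) (2 * a j) → y ≡ x mod gcd (2 * a j) (2 * a i)
  compatible-sym {i} {j} = ≡-mod-sym ∘ subst (λ d → _ ≡ _ mod d) (gcd-comm (2 * a i) (2 * a j))

-- χ b is literally the summand of countB, so countB p (x ∷ xs) ≡ χ (p x) + countB p xs holds by refl.
χ : Bool → ℕ
χ b = if b then 1 else 0

χ-T : ∀ {b} → T b → χ b ≡ 1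
χ-T {true} _ = refl

χ-¬T : ∀ {b} → ¬ T b → χ b ≡ 0
χ-¬T {false} _  = refl
χ-¬T {true}  ¬b = ⊥-elim (¬b _)

χ+χ≡if-∨ : ∀ p q j → (T p → q ≡ j) → (T q → p ≡ j) → χ q + χ p ≡ (if p ∨ q then suc (χ j) else 0)
χ+χ≡if-∨ true  q     j     p⇒q≡j _     rewrite p⇒q≡j _ = ℕ.+-comm (χ j) 1
χ+χ≡if-∨ false true  false _     _     = refl
χ+χ≡if-∨ false true  true  _     q⇒p≡j with () ← q⇒p≡j _
χ+χ≡if-∨ false false j     _     _     = refl

coordinate-sign-count : ∀ a .{{_ : NonZero a}} t {v} → v ≤ a →
  χ (negCongB (2 * a) t v) + χ (congB (2 * a) t v) ≡ (if fold a t ≡ᵇ v then suc (χ (negCongB (2 * a) v v)) else 0)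
coordinate-sign-count a t {v} v≤a =
  trans (χ+χ≡if-∨ p q j p⇒q≡j q⇒p≡j) (cong (λ b → if b then _ else 0) p∨q≡fold≡v)
  where
  m : ℕ
  m = 2 * a
  p : Bool
  p = congB m t v
  q : Bool
  q = negCongB m t v
  j : Bool
  j = negCongB m v v
  p-reflects : Reflects (+ t ≡ + v mod m) p
  p-reflects = congB-reflects m t v
  q-reflects : Reflects (+ t ≡ - + v mod m) q
  q-reflects = negCongB-reflects m t v
  j-reflects : Reflects (+ v ≡ - + v mod m) j
  j-reflects = negCongB-reflects m v v
  p⇒q≡j : T p → q ≡ j
  p⇒q≡j tp = det (map-reflects (mk⇔ (≡-mod-trans (≡-mod-sym t≡v)) (≡-mod-trans t≡v)) q-reflects) j-reflects
    where t≡v = to (reflects-T⇔ p-reflects) tp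
  q⇒p≡j : T q → p ≡ j
  q⇒p≡j tq = det (map-reflects (mk⇔ (λ t≡v → ≡-mod-trans (≡-mod-sym t≡v) t≡-v) (≡-mod-trans t≡-v ∘ ≡-mod-sym))
                               p-reflects)
                 j-reflects
    where t≡-v = to (reflects-T⇔ q-reflects) tq
  p∨q≡fold≡v : p ∨ q ≡ (fold a t ≡ᵇ v)
  p∨q≡fold≡v = det (map-reflects (⇔.sym (fold≡⇔ a v≤a)) (p-reflects ⊎-reflects q-reflects))
                   (≡ᵇ-reflects-≡ (fold a t) v)

module _ {A : Set} where

  countB-++ : ∀ (p : A → Bool) xs ys → countB p (xs ++ ys) ≡ countB p xs + countB p ys
  countB-++ p []       ys = refl
  countB-++ p (x ∷ xs) ys = trans (cong (_+_ (χ (p x))) (countB-++ p xs ys)) (sym (ℕ.+-assoc (χ (p x)) _ _))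

  countB-cong : ∀ {p q : A → Bool} {xs} → All (λ x → p x ≡ q x) xs → countB p xs ≡ countB q xs
  countB-cong []             = refl
  countB-cong (px≡qx ∷ eqs) = cong₂ _+_ (cong χ px≡qx) (countB-cong eqs)

  countB-none : ∀ (p : A → Bool) {xs} → All (λ x → ¬ T (p x)) xs → countB p xs ≡ 0
  countB-none p []                       = refl
  countB-none p {x ∷ _} (¬px ∷ ¬pxs) with p x
  ... | false = countB-none p ¬pxs
  ... | true  = ⊥-elim (¬px _)

  countB-∧ˡ : ∀ b (p : A → Bool) xs → countB (λ x → b ∧ p x) xs ≡ χ b * countB p xs
  countB-∧ˡ b p []       = sym (ℕ.*-zeroʳ (χ b))
  countB-∧ˡ b p (x ∷ xs) = trans (cong₂ _+_ (χ-∧ b (p x)) (countB-∧ˡ b p xs)) (sym (ℕ.*-distribˡ-+ (χ b) _ _))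
    where
    χ-∧ : ∀ b c → χ (b ∧ c) ≡ χ b * χ c
    χ-∧ false c = refl
    χ-∧ true  c = sym (ℕ.+-identityʳ (χ c))

  countB≡sum : ∀ (p : A → Bool) xs → countB p xs ≡ sum (map (χ ∘ p) xs)
  countB≡sum p []       = refl
  countB≡sum p (x ∷ xs) = cong (_+_ (χ (p x))) (countB≡sum p xs)

  sum-map-+ : ∀ (f g : A → ℕ) xs → sum (map (λ x → f x + g x) xs) ≡ sum (map f xs) + sum (map g xs)
  sum-map-+ f g []       = refl
  sum-map-+ f g (x ∷ xs) = trans (cong (_+_ (f x + g x)) (sum-map-+ f g xs)) (interchange (f x) (g x) _ _)
    where
    interchange : ∀ a b c d → a + b + (c + d) ≡ a + c + (b + d)
    interchange = solve-∀

  sum-map-* : ∀ c (f : A → ℕ) xs → sum (map (λ x → c * f x) xs) ≡ c * sum (map f xs)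
  sum-map-* c f []       = sym (ℕ.*-zeroʳ c)
  sum-map-* c f (x ∷ xs) = trans (cong (_+_ (c * f x)) (sum-map-* c f xs)) (sym (ℕ.*-distribˡ-+ c (f x) _))

countB-applyUpTo : ∀ {A : Set} (p : A → Bool) f n → countB p (applyUpTo f n) ≡ countB (p ∘ f) (upTo n)
countB-applyUpTo p f zero    = refl
countB-applyUpTo p f (suc n) =
  cong (_+_ (χ (p (f 0)))) (trans (countB-applyUpTo p (f ∘ suc) n) (sym (countB-applyUpTo (p ∘ f) suc n)))

countB-comm : ∀ {A B : Set} (R : A → B → Bool) xs ys →
  sum (map (λ x → countB (R x) ys) xs) ≡ sum (map (λ y → countB (λ x → R x y) xs) ys)
countB-comm R [] ys = sym (sum-map-0 ys)
  where
  sum-map-0 : ∀ ys → sum (map (λ _ → 0) ys) ≡ 0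
  sum-map-0 []       = refl
  sum-map-0 (_ ∷ ys) = sum-map-0 ys
countB-comm R (x ∷ xs) ys = begin
  countB (R x) ys + sum (map (λ x′ → countB (R x′) ys) xs)
    ≡⟨ cong₂ _+_ (countB≡sum (R x) ys) (countB-comm R xs ys) ⟩
  sum (map (χ ∘ R x) ys) + sum (map (λ y → countB (λ x′ → R x′ y) xs) ys)
    ≡⟨ sum-map-+ (χ ∘ R x) (λ y → countB (λ x′ → R x′ y) xs) ys ⟨
  sum (map (λ y → countB (λ x′ → R x′ y) (x ∷ xs)) ys)
    ∎
  where open ≡-Reasoning

countB-upTo-cong : ∀ {p q : ℕ → Bool} n → (∀ {t} → t < n → p t ≡ q t) →
  countB p (upTo n) ≡ countB q (upTo n)
countB-upTo-cong n p≡q = countB-cong (applyUpTo⁺₁ id n p≡q)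

countB-upTo-suc : ∀ (p : ℕ → Bool) n → countB p (upTo (suc n)) ≡ countB p (upTo n) + χ (p n)
countB-upTo-suc p n = begin
  countB p (upTo (suc n))             ≡⟨ cong (countB p) (List.upTo-∷ʳ n) ⟨
  countB p (upTo n ++ [ n ])          ≡⟨ countB-++ p (upTo n) [ n ] ⟩
  countB p (upTo n) + (χ (p n) + 0)   ≡⟨ cong (_+_ (countB p (upTo n))) (ℕ.+-identityʳ (χ (p n))) ⟩
  countB p (upTo n) + χ (p n)         ∎
  where open ≡-Reasoning

countB-upTo-reverse : ∀ (p : ℕ → Bool) n → countB p (upTo n) ≡ countB (λ t → p (n ∸ suc t)) (upTo n)
countB-upTo-reverse p zero    = refl
countB-upTo-reverse p (suc n) = begin
  countB p (upTo (suc n))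
    ≡⟨ countB-upTo-suc p n ⟩
  countB p (upTo n) + χ (p n)
    ≡⟨ ℕ.+-comm _ (χ (p n)) ⟩
  χ (p n) + countB p (upTo n)
    ≡⟨ cong (_+_ (χ (p n))) (countB-upTo-reverse p n) ⟩
  χ (p n) + countB (λ t → p (n ∸ suc t)) (upTo n)
    ≡⟨ cong (_+_ (χ (p n))) (countB-applyUpTo (λ t → p (suc n ∸ suc t)) suc n) ⟨
  countB (λ t → p (suc n ∸ suc t)) (upTo (suc n))
    ∎
  where open ≡-Reasoning

applyUpTo-+ : ∀ {A : Set} (f : ℕ → A) m n → applyUpTo f (m + n) ≡ applyUpTo f m ++ applyUpTo (f ∘ (_+_ m)) n
applyUpTo-+ f zero    n = refl
applyUpTo-+ f (suc m) n = cong (f 0 ∷_) (applyUpTo-+ (f ∘ suc) m n)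

countB-upTo-+ : ∀ (p : ℕ → Bool) m n →
  countB p (upTo (m + n)) ≡ countB p (upTo m) + countB (p ∘ (_+_ m)) (upTo n)
countB-upTo-+ p m n = begin
  countB p (upTo (m + n))
    ≡⟨ cong (countB p) (applyUpTo-+ id m n) ⟩
  countB p (upTo m ++ applyUpTo (_+_ m) n)
    ≡⟨ countB-++ p (upTo m) _ ⟩
  countB p (upTo m) + countB p (applyUpTo (_+_ m) n)
    ≡⟨ cong (_+_ (countB p (upTo m))) (countB-applyUpTo p (_+_ m) n) ⟩
  countB p (upTo m) + countB (p ∘ (_+_ m)) (upTo n)
    ∎
  where open ≡-Reasoning

countB-upTo-double : ∀ (p : ℕ → Bool) L → ¬ T (p 0) → ¬ T (p L) →
  (∀ {t} → t ≤ 2 * L → p (2 * L ∸ t) ≡ p t) →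
  countB p (upTo (2 * L)) ≡ countB p (upTo (suc L)) + countB p (upTo (suc L))
countB-upTo-double p L ¬p0 ¬pL p-symmetric = begin
  countB p (upTo (2 * L))
    ≡⟨ cong (countB p ∘ upTo) (2*a≡a+a L) ⟩
  countB p (upTo (L + L))
    ≡⟨ countB-upTo-+ p L L ⟩
  countB p (upTo L) + countB (p ∘ (_+_ L)) (upTo L)
    ≡⟨ cong (_+_ (countB p (upTo L))) (countB-upTo-reverse (p ∘ (_+_ L)) L) ⟩
  countB p (upTo L) + countB (λ t → p (L + (L ∸ suc t))) (upTo L)
    ≡⟨ cong (_+_ (countB p (upTo L))) (countB-upTo-cong L reflect) ⟩
  countB p (upTo L) + countB (p ∘ suc) (upTo L)
    ≡⟨ cong₂ _+_ drop-last drop-first ⟩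
  countB p (upTo (suc L)) + countB p (upTo (suc L))
    ∎
  where
  open ≡-Reasoning
  reflect : ∀ {t} → t < L → p (L + (L ∸ suc t)) ≡ p (suc t)
  reflect {t} t<L = trans (cong p (trans (sym (ℕ.+-∸-assoc L t<L)) (cong (_∸ suc t) (sym (2*a≡a+a L)))))
                          (p-symmetric (ℕ.≤-trans t<L (ℕ.≤-trans (ℕ.m≤n+m L L) (ℕ.≤-reflexive (sym (2*a≡a+a L))))))
  drop-last : countB p (upTo L) ≡ countB p (upTo (suc L))
  drop-last = sym (trans (countB-upTo-suc p L) (trans (cong (_+_ (countB p (upTo L))) (χ-¬T ¬pL)) (ℕ.+-identityʳ _)))
  drop-first : countB (p ∘ suc) (upTo L) ≡ countB p (upTo (suc L))
  drop-first = sym (trans (cong (_+ countB p (applyUpTo suc L)) (χ-¬T ¬p0)) (countB-applyUpTo p suc L))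

countB-upTo-unique : ∀ {p : ℕ → Bool} {N t₀} → t₀ < N → T (p t₀) → (∀ {t} → t < N → T (p t) → t ≡ t₀) →
  countB p (upTo N) ≡ 1
countB-upTo-unique {p} {suc N} {t₀} t₀<1+N pt₀ unique with ℕ.<-cmp t₀ N
... | tri< t₀<N _ _ = begin
  countB p (upTo (suc N))      ≡⟨ countB-upTo-suc p N ⟩
  countB p (upTo N) + χ (p N)  ≡⟨ cong₂ _+_ (countB-upTo-unique t₀<N pt₀ (unique ∘ ℕ.m<n⇒m<1+n)) (χ-¬T ¬pN) ⟩
  1                            ∎
  where
  open ≡-Reasoning
  ¬pN : ¬ T (p N)
  ¬pN pN = ℕ.<-irrefl (sym (unique ℕ.≤-refl pN)) t₀<N
... | tri≈ _ refl _ = trans (countB-upTo-suc p N) (cong₂ _+_ (countB-none p (applyUpTo⁺₁ id N ¬p)) (χ-T pt₀))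
  where
  ¬p : ∀ {t} → t < t₀ → ¬ T (p t)
  ¬p t<t₀ pt = ℕ.<-irrefl (unique (ℕ.m<n⇒m<1+n t<t₀) pt) t<t₀
... | tri> _ _ t₀>N = ⊥-elim (ℕ.<-irrefl refl (ℕ.<-≤-trans t₀>N (ℕ.≤-pred t₀<1+N)))

countB-concatMap-pair : ∀ {A B : Set} (p : B → Bool) (f h : A → B) xs →
  countB p (concatMap (λ x → f x ∷ h x ∷ []) xs) ≡ countB (p ∘ f) xs + countB (p ∘ h) xs
countB-concatMap-pair p f h []       = refl
countB-concatMap-pair p f h (x ∷ xs) =
  trans (cong (λ c → χ (p (f x)) + (χ (p (h x)) + c)) (countB-concatMap-pair p f h xs))
        (interchange (χ (p (f x))) (χ (p (h x))) (countB (p ∘ f) xs) (countB (p ∘ h) xs))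
  where
  interchange : ∀ a b c d → a + (b + (c + d)) ≡ a + c + (b + d)
  interchange = solve-∀

countB-allAssignments : ∀ n (q : Fin n → Bool → Bool) →
  countB (λ g → allFinB n (λ i → q i (g i))) (allAssignments n) ≡
  product (tabulate (λ i → χ (q i false) + χ (q i true)))
countB-allAssignments zero    q = refl
countB-allAssignments (suc n) q = begin
  countB sat (allAssignments (suc n))
    ≡⟨ countB-concatMap-pair sat (consB false) (consB true) assignments ⟩
  countB (λ g → q zero false ∧ sat′ g) assignments + countB (λ g → q zero true ∧ sat′ g) assignments
    ≡⟨ cong₂ _+_ (countB-∧ˡ (q zero false) sat′ assignments) (countB-∧ˡ (q zero true) sat′ assignments) ⟩
  χ (q zero false) * countB sat′ assignments + χ (q zero true) * countB sat′ assignments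
    ≡⟨ ℕ.*-distribʳ-+ (countB sat′ assignments) (χ (q zero false)) (χ (q zero true)) ⟨
  (χ (q zero false) + χ (q zero true)) * countB sat′ assignments
    ≡⟨ cong ((χ (q zero false) + χ (q zero true)) *_) (countB-allAssignments n (q ∘ suc)) ⟩
  product (tabulate (λ i → χ (q i false) + χ (q i true)))
    ∎
  where
  open ≡-Reasoning
  sat : (Fin (suc n) → Bool) → Bool
  sat g = allFinB (suc n) (λ i → q i (g i))
  sat′ : (Fin n → Bool) → Bool
  sat′ g = allFinB n (λ i → q (suc i) (g i))
  assignments : List (Fin n → Bool)
  assignments = allAssignments n

product-tabulate-if : ∀ {n} (P : Fin n → Bool) (c : Fin n → ℕ) →
  product (tabulate (λ i → if P i then c i else 0)) ≡ (if allFinB n P then product (tabulate c) else 0)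
product-tabulate-if {zero}  P c = refl
product-tabulate-if {suc n} P c with P zero
... | false = refl
... | true  = trans (cong (c zero *_) (product-tabulate-if (P ∘ suc) (c ∘ suc))) (*-if (allFinB n (P ∘ suc)))
  where
  *-if : ∀ b → c zero * (if b then product (tabulate (c ∘ suc)) else 0) ≡
              (if b then c zero * product (tabulate (c ∘ suc)) else 0)
  *-if true  = refl
  *-if false = ℕ.*-zeroʳ (c zero)

product-tabulate-2^ : ∀ {n} {A : Set} (J : A → Bool) (f : Fin n → A) →
  product (tabulate (λ i → suc (χ (J (f i))))) ≡ 2 ^ countB J (tabulate f)
product-tabulate-2^ {zero}  J f = refl
product-tabulate-2^ {suc n} J f = begin
  suc (χ (J (f zero))) * product (tabulate (λ i → suc (χ (J (f (suc i))))))
    ≡⟨ cong₂ _*_ (sym (2^χ (J (f zero)))) (product-tabulate-2^ J (f ∘ suc)) ⟩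
  2 ^ χ (J (f zero)) * 2 ^ countB J (tabulate (f ∘ suc))
    ≡⟨ ℕ.^-distribˡ-+-* 2 (χ (J (f zero))) _ ⟨
  2 ^ countB J (tabulate f)
    ∎
  where
  open ≡-Reasoning
  2^χ : ∀ b → 2 ^ χ b ≡ suc (χ b)
  2^χ false = refl
  2^χ true  = refl

-- A zero-dimensional table is a single corner.
nonCorner⇒index : ∀ {n} {a v : Fin n → ℕ} → ¬ IsCorner a v → Fin n
nonCorner⇒index {zero}  ¬corner = ⊥-elim (¬corner λ ())
nonCorner⇒index {suc n} _       = zero

module Billiard {n : ℕ} (a : Fin n → ℕ) (a≢0 : ∀ i → NonZero (a i))
                (v : Fin n → ℕ) (v≤a : ∀ i → v i ≤ a i) where

  L : ℕ
  L = lcmAll n a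

  instance
    L≢0 : NonZero L
    L≢0 = lcmAll-nonZero a a≢0

  at-v : ℕ → Bool
  at-v t = samePointB (pos a t) v

  at-v-reflects : ∀ t → Reflects (∀ i → fold (a i) t ≡ v i) (at-v t)
  at-v-reflects t = allFinB-reflects λ i → ≡ᵇ-reflects-≡ (fold (a i) t) (v i)

  corner⇒lcm∣ : ∀ {s} → IsCorner a (pos a s) → L ℕ.∣ s
  corner⇒lcm∣ {s} corner = lcmAll-least a λ i → to (fold-at-wall⇔∣ (a i) {{a≢0 i}} s) (corner i)

  notStoppedBefore-≤lcm : ∀ {t} → t ≤ L → T (notStoppedBefore a t)
  notStoppedBefore-≤lcm {zero}  _     = _
  notStoppedBefore-≤lcm {suc t} 1+t≤L = T-allB (map⁺ (applyUpTo⁺₁ id t λ {u} u<t →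
    from (reflects-T⇔ (¬-reflects (isCornerB-reflects a (pos a (suc u)))))
      λ corner → ℕ.<-irrefl refl (ℕ.<-≤-trans (ℕ.<-≤-trans (ℕ.s<s u<t) 1+t≤L) (ℕ.∣⇒≤ (corner⇒lcm∣ corner)))))

  crossingNumber-as-count : crossingNumber a v ≡ countB at-v (upTo (suc L))
  crossingNumber-as-count = countB-upTo-cong (suc L) λ {t} t<1+L →
    trans (cong (at-v t ∧_) (to Bool.T-≡ (notStoppedBefore-≤lcm (ℕ.≤-pred t<1+L)))) (Bool.∧-identityʳ (at-v t))

  2a∣2L : ∀ i → 2 * a i ℕ.∣ 2 * L
  2a∣2L i = ℕ.*-monoʳ-∣ 2 (m∣lcmAll a i)

  at-v-reflect : ∀ {t} → t ≤ 2 * L → at-v (2 * L ∸ t) ≡ at-v t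
  at-v-reflect {t} t≤2L =
    det (map-reflects (mk⇔ (λ at i → trans (sym (fold-reflect i)) (at i)) (λ at i → trans (fold-reflect i) (at i)))
                      (at-v-reflects (2 * L ∸ t)))
        (at-v-reflects t)
    where
    fold-reflect : ∀ i → fold (a i) (2 * L ∸ t) ≡ fold (a i) t
    fold-reflect i = fold-cong (a i) {{a≢0 i}} (inj₂ (+[N∸r]≡-+r (2a∣2L i) t≤2L))

  lcm∣⇒¬at-v : ∀ {t} → ¬ IsCorner a v → L ℕ.∣ t → ¬ T (at-v t)
  lcm∣⇒¬at-v {t} ¬corner L∣t at-v-t = ¬corner λ i →
    subst (λ w → w ≡ 0 ⊎ w ≡ a i) (at i)
          (from (fold-at-wall⇔∣ (a i) {{a≢0 i}} t) (ℕ.∣-trans (m∣lcmAll a i) L∣t))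
    where at = to (reflects-T⇔ (at-v-reflects t)) at-v-t

  count-at-v-period : ¬ IsCorner a v → countB at-v (upTo (2 * L)) ≡ crossingNumber a v + crossingNumber a v
  count-at-v-period ¬corner = begin
    countB at-v (upTo (2 * L))
      ≡⟨ countB-upTo-double at-v L (lcm∣⇒¬at-v ¬corner (L ℕ.∣0)) (lcm∣⇒¬at-v ¬corner ℕ.∣-refl) at-v-reflect ⟩
    countB at-v (upTo (suc L)) + countB at-v (upTo (suc L))
      ≡⟨ cong₂ _+_ crossingNumber-as-count crossingNumber-as-count ⟨
    crossingNumber a v + crossingNumber a v
      ∎
    where open ≡-Reasoning

  sign-solves : Fin n → ℕ → Bool → Bool
  sign-solves i t b = if b then congB (2 * a i) t (v i) else negCongB (2 * a i) t (v i)

  signs-solve : ℕ → (Fin n → Bool) → Bool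
  signs-solve t g = allFinB n (λ i → sign-solves i t (g i))

  signs-solve-reflects : ∀ t g → Reflects (∀ i → + t ≡ signed (g i) (v i) mod (2 * a i)) (signs-solve t g)
  signs-solve-reflects t g = allFinB-reflects λ i → sign-solves-reflects i (g i)
    where
    sign-solves-reflects : ∀ i b → Reflects (+ t ≡ signed b (v i) mod (2 * a i)) (sign-solves i t b)
    sign-solves-reflects i true  = congB-reflects (2 * a i) t (v i)
    sign-solves-reflects i false = negCongB-reflects (2 * a i) t (v i)

  count-sign-vectors : ∀ t → countB (signs-solve t) (allAssignments n) ≡ 2 ^ sizeJ a v * χ (at-v t)
  count-sign-vectors t = begin
    countB (signs-solve t) (allAssignments n)
      ≡⟨ countB-allAssignments n (λ i → sign-solves i t) ⟩
    product (tabulate (λ i → χ (sign-solves i t false) + χ (sign-solves i t true)))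
      ≡⟨ cong product (List.tabulate-cong λ i → coordinate-sign-count (a i) {{a≢0 i}} t (v≤a i)) ⟩
    product (tabulate (λ i → if fold (a i) t ≡ᵇ v i then suc (χ (J i)) else 0))
      ≡⟨ product-tabulate-if (λ i → fold (a i) t ≡ᵇ v i) (λ i → suc (χ (J i))) ⟩
    (if at-v t then product (tabulate (λ i → suc (χ (J i)))) else 0)
      ≡⟨ cong (λ k → if at-v t then k else 0) (product-tabulate-2^ J id) ⟩
    (if at-v t then 2 ^ sizeJ a v else 0)
      ≡⟨ if≡*χ (at-v t) ⟩
    2 ^ sizeJ a v * χ (at-v t)
      ∎
    where
    open ≡-Reasoning
    J : Fin n → Bool
    J i = negCongB (2 * a i) (v i) (v i)
    if≡*χ : ∀ b → (if b then 2 ^ sizeJ a v else 0) ≡ 2 ^ sizeJ a v * χ b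
    if≡*χ true  = sym (ℕ.*-identityʳ (2 ^ sizeJ a v))
    if≡*χ false = sym (ℕ.*-zeroʳ (2 ^ sizeJ a v))

  count-solving-times : ¬ IsCorner a v → ∀ g →
    countB (λ t → signs-solve t g) (upTo (2 * L)) ≡ χ (satisfyingB (phi a v) g)
  count-solving-times ¬corner g with satisfyingB (phi a v) g | satisfyingB-reflects a v g
  ... | false | ofⁿ incompatible = countB-none (λ t → signs-solve t g) (applyUpTo⁺₁ id (2 * L) λ _ solves →
          incompatible (solution⇒compatible (to (reflects-T⇔ (signs-solve-reflects _ g)) solves)))
  ... | true  | ofʸ compatible =
          countB-upTo-unique t₀<2L (from (reflects-T⇔ (signs-solve-reflects t₀ g)) t₀-solves) unique
    where
    instance
      2L≢0 : NonZero (2 * L)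
      2L≢0 = ℕ.m*n≢0 2 L
    solution : ∃ λ x → ∀ i → x ≡ signed (g i) (v i) mod (2 * a i)
    solution = crt (λ i → 2 * a i) (λ i → signed (g i) (v i)) (λ i → ℕ.m*n≢0 2 (a i) {{_}} {{a≢0 i}}) compatible
    x : ℤ
    x = proj₁ solution
    t₀ : ℕ
    t₀ = x %ℕ (2 * L)
    t₀<2L : t₀ < 2 * L
    t₀<2L = n%ℕd<d x (2 * L)
    t₀-solves : ∀ i → + t₀ ≡ signed (g i) (v i) mod (2 * a i)
    t₀-solves i = ≡-mod-trans (≡-mod-weaken (2a∣2L i) (≡-mod-sym (%ℕ-≡-mod x))) (proj₂ solution i)
    unique : ∀ {t} → t < 2 * L → T (signs-solve t g) → t ≡ t₀
    unique {t} t<2L solves =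
      +≡+-mod⇒≡ ∣t-t₀∣<2L (≡-mod-*lcmAll a 2 (≡-mod-weaken (ℕ.m∣m*n (a i₀)) (t≡t₀ i₀)) t≡t₀)
      where
      i₀ : Fin n
      i₀ = nonCorner⇒index ¬corner
      t≡t₀ : ∀ i → + t ≡ + t₀ mod (2 * a i)
      t≡t₀ i = ≡-mod-trans (to (reflects-T⇔ (signs-solve-reflects t g)) solves i) (≡-mod-sym (t₀-solves i))
      ∣t-t₀∣<2L : ℕ.∣ t - t₀ ∣ < 2 * L
      ∣t-t₀∣<2L = ℕ.≤-<-trans (ℕ.∣m-n∣≤m⊔n t t₀) (ℕ.⊔-lub t<2L t₀<2L)

  numSatisfying-double-count : ¬ IsCorner a v →
    numSatisfying (phi a v) ≡ 2 ^ sizeJ a v * (crossingNumber a v + crossingNumber a v)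
  numSatisfying-double-count ¬corner = begin
    countB sat assignments
      ≡⟨ countB≡sum sat assignments ⟩
    sum (map (χ ∘ sat) assignments)
      ≡⟨ cong sum (List.map-cong (sym ∘ count-solving-times ¬corner) assignments) ⟩
    sum (map (λ g → countB (λ t → signs-solve t g) times) assignments)
      ≡⟨ countB-comm (λ g t → signs-solve t g) assignments times ⟩
    sum (map (λ t → countB (signs-solve t) assignments) times)
      ≡⟨ cong sum (List.map-cong count-sign-vectors times) ⟩
    sum (map (λ t → 2 ^ sizeJ a v * χ (at-v t)) times)
      ≡⟨ sum-map-* (2 ^ sizeJ a v) (χ ∘ at-v) times ⟩
    2 ^ sizeJ a v * sum (map (χ ∘ at-v) times)
      ≡⟨ cong (2 ^ sizeJ a v *_) (countB≡sum at-v times) ⟨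
    2 ^ sizeJ a v * countB at-v times
      ≡⟨ cong (2 ^ sizeJ a v *_) (count-at-v-period ¬corner) ⟩
    2 ^ sizeJ a v * (crossingNumber a v + crossingNumber a v)
      ∎
    where
    open ≡-Reasoning
    sat : (Fin n → Bool) → Bool
    sat = satisfyingB (phi a v)
    assignments : List (Fin n → Bool)
    assignments = allAssignments n
    times : List ℕ
    times = upTo (2 * L)

lemma5 : (n : ℕ) (a : Fin n → ℕ) → (∀ i → 0 < a i)
       → (v : Fin n → ℕ) → (∀ i → v i ≤ a i) → ¬ IsCorner a v
       → crossingNumber a v * 2 ^ (sizeJ a v + 1) ≡ numSatisfying (phi a v)
lemma5 n a a>0 v v≤a ¬corner = begin
  crossingNumber a v * 2 ^ (sizeJ a v + 1)
    ≡⟨ cong (crossingNumber a v *_) (ℕ.^-distribˡ-+-* 2 (sizeJ a v) 1) ⟩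
  crossingNumber a v * (2 ^ sizeJ a v * 2)
    ≡⟨ rearrange (crossingNumber a v) (2 ^ sizeJ a v) ⟩
  2 ^ sizeJ a v * (crossingNumber a v + crossingNumber a v)
    ≡⟨ numSatisfying-double-count ¬corner ⟨
  numSatisfying (phi a v)
    ∎
  where
  open ≡-Reasoning
  open Billiard a (λ i → ℕ.>-nonZero (a>0 i)) v v≤a
  rearrange : ∀ c p → c * (p * 2) ≡ p * (c + c)
  rearrange = solve-∀
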